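{- Let $(G,\mathcal{C},\{w_v\}_{v\in V(G)},p,k,k^\star)$ be an instance of Target Weighted Gerrymandering where $G$ is the path $(u_1,\dots,u_n)$, fix a tie-breaking rule $\eta$, and let $H$ be the auxiliary labeled directed multigraph described below. Then there is a path on $k+2$ vertices from $s$ to $t$ in $H$ that has $k-k^\star$ labeled arcs, all with pairwise distinct labels, and $k^\star+1$ unlabeled arcs, if and only if $V(G)$ can be partitioned into $k$ districts such that $p$ wins in $k^\star$ districts and every other candidate wins in at most $k^\star-1$ districts.
   Context: A district is a nonempty $U\subseteq V(G)$ with $G[U]$ connected; on the path $G$ these are exactly the subpaths $P_{i,j}=(u_i,\dots,u_j)$, $1\le i\le j\le n$. A tie-breaking rule $\eta$ assigns to every district $U$ a single winner $\eta(U)\in\arg\max_{q\in\mathcal{C}}\sum_{v\in U}w_v(q)$. Target Weighted Gerrymandering has as input a graph $G$, candidates $\mathcal{C}$, weight functions $w_v\colon\mathcal{C}\to\mathbb{Z}^+$, a distinguished candidate $p$ and positive integers $k,k^\star$. The directed multigraph $H$ is defined as follows. For each $1\le i\le j\le n$ there is a vertex $v_{i,j}$, and there are two further vertices $s,t$. For each $1\le i\le j\le n$, let $c$ be the winner of $P_{i,j}$; for each $r\in\{j+1,\dots,n\}$: if $c\neq p$, add $k^\star-1$ parallel arcs from $v_{i,j}$ to $v_{j+1,r}$, labeled $\langle c,1\rangle,\dots,\langle c,k^\star-1\rangle$ respectively; if $c=p$, add one unlabeled arc from $v_{i,j}$ to $v_{j+1,r}$. For each $i\in\{1,\dots,n\}$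 add an unlabeled arc from $s$ to $v_{1,i}$. For each $i\in\{1,\dots,n\}$, let $c$ be the winner of $P_{i,n}$: if $c\ne p$, add $k^\star-1$ arcs from $v_{i,n}$ to $t$ labeled $\langle c,1\rangle,\dots,\langle c,k^\star-1\rangle$; if $c=p$, add one unlabeled arc from $v_{i,n}$ to $t$. A path in $H$ is a sequence of distinct vertices joined by arcs in the forward direction. -}

module Defs where

open import Data.Nat using (ℕ; zero; suc; _+_; _∸_; _≤_; _<_; _≤?_)
open import Data.Nat.Properties using ()
open import Data.Fin using (Fin)
open import Data.Fin.Properties using () renaming (_≟_ to _≟ᶠ_)
open import Data.Nat.ListAction using (sum)
open import Data.List using (List; []; _∷_; map; upTo; length; filter; mapMaybe)
open import Data.List.Relation.Unary.All using (All)
open import Data.List.Relation.Unary.Unique.Propositional using (Unique)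
open import Data.Maybe using (Maybe; just; nothing; is-nothing)
open import Data.Maybe.Base using () renaming (is-nothing to isNothing)
open import Data.Bool using (T)
open import Data.Product using (_×_; _,_; proj₁; proj₂)
open import Function using (id)
open import Relation.Binary.PropositionalEquality using (_≡_; _≢_)
open import Relation.Nullary.Decidable using (_×-dec_; T?)

-- Conventions: the path G = (u_1,…,u_n) has vertex set {1,…,n} (1-based
-- natural numbers); candidates are Fin m.  Weights are w : ℕ → Fin m → ℕ,
-- only the values at 1,…,n matter.

range : ℕ → ℕ → List ℕ
range i j = map (i +_) (upTo (suc j ∸ i))

score : {m : ℕ} → (ℕ → Fin m → ℕ) → ℕ → ℕ → Fin m → ℕ
score w i j q = sum (map (λ v → w v q) (range i j))

PositiveWeights : (n m : ℕ) → (ℕ → Fin m → ℕ) → Set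
PositiveWeights n m w = ∀ v → 1 ≤ v → v ≤ n → ∀ q → 1 ≤ w v q

IsTieBreaking : (n m : ℕ) → (ℕ → Fin m → ℕ) → (ℕ → ℕ → Fin m) → Set
IsTieBreaking n m w η =
  ∀ i j → 1 ≤ i → i ≤ j → j ≤ n → ∀ q → score w i j q ≤ score w i j (η i j)

data HV : Set where
  s : HV
  t : HV
  v : ℕ → ℕ → HV

-- a label ⟨c,ℓ⟩; unlabeled arcs carry  nothing
Label : ℕ → Set
Label m = Fin m × ℕ

module AuxGraph (n m : ℕ) (η : ℕ → ℕ → Fin m) (p : Fin m) (kstar : ℕ) where

  -- Arc x y l : an arc of H from x to y with (optional) label l.
  -- Parallel arcs are distinguished by their labels.
  data Arc : HV → HV → Maybe (Label m) → Set where
    vv-lab : ∀ i j r ℓ → 1 ≤ i → i ≤ j → j < r → r ≤ n → η i j ≢ p →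
             1 ≤ ℓ → ℓ ≤ kstar ∸ 1 → Arc (v i j) (v (suc j) r) (just (η i j , ℓ))
    vv-unl : ∀ i j r → 1 ≤ i → i ≤ j → j < r → r ≤ n → η i j ≡ p →
             Arc (v i j) (v (suc j) r) nothing
    sv     : ∀ i → 1 ≤ i → i ≤ n → Arc s (v 1 i) nothing
    vt-lab : ∀ i ℓ → 1 ≤ i → i ≤ n → η i n ≢ p →
             1 ≤ ℓ → ℓ ≤ kstar ∸ 1 → Arc (v i n) t (just (η i n , ℓ))
    vt-unl : ∀ i → 1 ≤ i → i ≤ n → η i n ≡ p → Arc (v i n) t nothing

  data Walk : HV → HV → List HV → List (Maybe (Label m)) → Set where
    here : ∀ {x} → Walk x x (x ∷ []) []
    step : ∀ {x y z l vs ls} → Arc x y l → Walk y z vs ls → Walk x z (x ∷ vs) (l ∷ ls)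

  record GoodPath (k : ℕ) : Set where
    constructor mk
    field
      vs             : List HV
      ls             : List (Maybe (Label m))
      walk           : Walk s t vs ls
      distinct       : Unique vs
      nVerts         : length vs ≡ k + 2
      nLabeled       : length (mapMaybe id ls) ≡ k ∸ kstar
      labelsDistinct : Unique (mapMaybe id ls)
      nUnlabeled     : length (filter (λ l → T? (isNothing l)) ls) ≡ kstar + 1

  -- Partitions of V(G) = {1,…,n} into districts.  On a path the districts
  -- are exactly the subpaths P_{i,j}, represented by the pair (i , j).

  ValidDistrict : ℕ × ℕ → Set
  ValidDistrict (i , j) = 1 ≤ i × i ≤ j × j ≤ n

  countContaining : ℕ → List (ℕ × ℕ) → ℕ
  countContaining u ds = length (filter (λ d → (proj₁ d ≤? u) ×-dec (u ≤? proj₂ d)) ds)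

  wins : Fin m → List (ℕ × ℕ) → ℕ
  wins q ds = length (filter (λ d → η (proj₁ d) (proj₂ d) ≟ᶠ q) ds)

  record GoodPartition (k : ℕ) : Set where
    constructor mk
    field
      ds        : List (ℕ × ℕ)
      valid     : All ValidDistrict ds
      covers    : ∀ u → 1 ≤ u → u ≤ n → countContaining u ds ≡ 1
      nDistricts : length ds ≡ k
      pWins     : wins p ds ≡ kstar
      othersWin : ∀ q → q ≢ p → wins q ds ≤ kstar ∸ 1

{-# OPTIONS --safe #-}
-- An s–t path in H is s, v_{a₁,b₁}, …, v_{a_k,b_k}, t with a₁ = 1, a_{r+1} = b_r + 1 and b_k = n,
-- i.e. a left-to-right tiling of G by k districts.  The arc leaving v_{i,j} is unlabelled exactly
-- when p wins P_{i,j}, and otherwise carries a label ⟨c,ℓ⟩ with c the winner and 1 ≤ ℓ ≤ k⋆−1,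
-- so pairwise distinct labels bound the wins of each c ≠ p by k⋆−1 (pigeonhole).  Conversely a
-- partition sorts into such a tiling, and labelling each district won by c ≠ p with its rank
-- among the districts won by c gives pairwise distinct labels.
module Submission where

open import Defs
open import Data.Nat using (ℕ; zero; suc; _+_; _∸_; _≤_; _<_; _≤?_; _≟_; z≤n; s≤s)
open import Data.Nat.Properties
open import Data.Fin using (Fin)
open import Data.Fin.Properties using () renaming (_≟_ to _≟ᶠ_)
open import Data.List using (List; []; _∷_; map; length; filter; mapMaybe)
open import Data.List.Properties using (filter-accept; filter-reject; filter-some; length-map)
open import Data.List.Relation.Unary.All as All using (All; []; _∷_)
import Data.List.Relation.Unary.All.Properties as All
import Data.List.Relation.Unary.Any as Any
open import Data.List.Relation.Unary.Any using (here; there)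
open import Data.List.Relation.Unary.AllPairs using ([]; _∷_)
open import Data.List.Relation.Unary.Unique.Propositional using (Unique)
import Data.List.Relation.Unary.Unique.Propositional.Properties as Unique
open import Data.List.Relation.Binary.Pointwise using (Pointwise; []; _∷_; Pointwise-length)
open import Data.List.Membership.Propositional using (_∈_)
open import Data.List.Membership.Propositional.Properties using (∈-∃++)
open import Data.List.Relation.Binary.Permutation.Propositional using (_↭_; ↭-refl; ↭-trans; prep)
open import Data.List.Relation.Binary.Permutation.Propositional.Properties
  using (shift; filter-↭; ↭-length; All-resp-↭)
open import Data.Maybe using (Maybe; just; nothing)
open import Data.Maybe.Base using () renaming (is-nothing to isNothing)
open import Data.Product using (∃; _×_; _,_; proj₁; proj₂)
open import Data.Empty using (⊥; ⊥-elim)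
open import Data.Unit using (⊤)
open import Function using (id; _∘_)
open import Function.Bundles using (_⇔_; mk⇔)
open import Relation.Binary.PropositionalEquality
  using (_≡_; _≢_; refl; sym; trans; cong; subst; module ≡-Reasoning)
open import Relation.Nullary using (¬_; yes; no)
open import Relation.Nullary.Decidable using (_×-dec_; T?; ¬?)
open import Relation.Unary using (Decidable)

module _ {A : Set} {P : A → Set} (P? : Decidable P) where

  count : List A → ℕ
  count xs = length (filter P? xs)

  count-accept : ∀ {x} xs → P x → count (x ∷ xs) ≡ suc (count xs)
  count-accept xs px = cong length (filter-accept P? px)

  count-reject : ∀ {x} xs → ¬ P x → count (x ∷ xs) ≡ count xs
  count-reject xs ¬px = cong length (filter-reject P? ¬px)

  count-≤-∷ : ∀ x xs → count xs ≤ count (x ∷ xs)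
  count-≤-∷ x xs with P? x
  ... | yes _ = n≤1+n _
  ... | no  _ = ≤-refl

  count-↭ : ∀ {xs ys} → xs ↭ ys → count xs ≡ count ys
  count-↭ xs↭ys = ↭-length (filter-↭ P? xs↭ys)

  ∈⇒1≤count : ∀ {x xs} → x ∈ xs → P x → 1 ≤ count xs
  ∈⇒1≤count x∈xs px = filter-some P? (Any.map (λ { refl → px }) x∈xs)

  1≤count⇒∈ : ∀ xs → 1 ≤ count xs → ∃ λ x → x ∈ xs × P x
  1≤count⇒∈ (x ∷ xs) pos with P? x
  ... | yes px = x , here refl , px
  ... | no  _  with y , y∈xs , py ← 1≤count⇒∈ xs pos = y , there y∈xs , py

  count+count-¬≡length : ∀ xs → count xs + length (filter (¬? ∘ P?) xs) ≡ length xs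
  count+count-¬≡length []       = refl
  count+count-¬≡length (x ∷ xs) with P? x
  ... | yes _ = cong suc (count+count-¬≡length xs)
  ... | no  _ = trans (+-suc _ _) (cong suc (count+count-¬≡length xs))

count-∷-cong : ∀ {A B : Set} {P : A → Set} {Q : B → Set} (P? : Decidable P) (Q? : Decidable Q) {x y xs ys} →
               (P x → Q y) → (Q y → P x) → count P? xs ≡ count Q? ys → count P? (x ∷ xs) ≡ count Q? (y ∷ ys)
count-∷-cong P? Q? {x} {y} px⇒qy qy⇒px eq with P? x | Q? y
... | yes _   | yes _   = cong suc eq
... | no  _   | no  _   = eq
... | yes px  | no  ¬qy = ⊥-elim (¬qy (px⇒qy px))
... | no  ¬px | yes qy  = ⊥-elim (¬px (qy⇒px qy))

unique-constant⇒length≤1 : ∀ {A : Set} {c : A} {xs} → Unique xs → All (_≡ c) xs → length xs ≤ 1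
unique-constant⇒length≤1 {xs = []}         _                 _              = z≤n
unique-constant⇒length≤1 {xs = _ ∷ []}     _                 _              = s≤s z≤n
unique-constant⇒length≤1 {xs = _ ∷ _ ∷ _} ((x≢y ∷ _) ∷ _) (x≡c ∷ y≡c ∷ _) = ⊥-elim (x≢y (trans x≡c (sym y≡c)))

unique-bounded⇒length≤ : ∀ K {ns : List ℕ} → Unique ns → All (λ x → 1 ≤ x × x ≤ K) ns → length ns ≤ K
unique-bounded⇒length≤ zero    {[]}    _ _                 = z≤n
unique-bounded⇒length≤ zero    {_ ∷ _} _ ((1≤x , x≤0) ∷ _) = ⊥-elim (1+n≰n (≤-trans 1≤x x≤0))
unique-bounded⇒length≤ (suc K) {ns} unique bounded = begin
  length ns                              ≡⟨ count+count-¬≡length top? ns ⟨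
  count top? ns + length (filter rest? ns) ≤⟨ +-mono-≤ atMostOneTop restBounded ⟩
  1 + K                                  ∎
  where
  open ≤-Reasoning
  top? : Decidable (_≡ suc K)
  top? x = x ≟ suc K
  rest? = ¬? ∘ top?
  atMostOneTop : count top? ns ≤ 1
  atMostOneTop = unique-constant⇒length≤1 (Unique.filter⁺ top? unique) (All.all-filter top? ns)
  restBounded : length (filter rest? ns) ≤ K
  restBounded = unique-bounded⇒length≤ K (Unique.filter⁺ rest? unique)
    (All.zipWith (λ { ((1≤x , x≤1+K) , x≢1+K) → 1≤x , ≤-pred (≤∧≢⇒< x≤1+K x≢1+K) })
      (All.filter⁺ rest? bounded , All.all-filter rest? ns))

fibre-map-proj₂ : ∀ {B : Set} {b : B} {xs : List (B × ℕ)} → All (λ l → proj₁ l ≡ b) xs →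
                  map (b ,_) (map proj₂ xs) ≡ xs
fibre-map-proj₂ []           = refl
fibre-map-proj₂ (refl ∷ eqs) = cong (_ ∷_) (fibre-map-proj₂ eqs)

unique-fibre⇒length≤ : ∀ {B : Set} K {b : B} {xs : List (B × ℕ)} → Unique xs →
                       All (λ l → proj₁ l ≡ b × 1 ≤ proj₂ l × proj₂ l ≤ K) xs → length xs ≤ K
unique-fibre⇒length≤ K {b} {xs} unique inFibre = begin
  length xs              ≡⟨ length-map proj₂ xs ⟨
  length (map proj₂ xs)  ≤⟨ unique-bounded⇒length≤ K uniqueIndices (All.map⁺ (All.map proj₂ inFibre)) ⟩
  K                      ∎
  where
  open ≤-Reasoning
  uniqueIndices : Unique (map proj₂ xs)
  uniqueIndices = Unique.map⁻ (subst Unique (sym (fibre-map-proj₂ (All.map proj₁ inFibre))) unique)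

module _ (n m : ℕ) (η : ℕ → ℕ → Fin m) (p : Fin m) (kstar : ℕ) where
  open AuxGraph n m η p kstar

  wonBy? : (q : Fin m) → Decidable (λ (d : ℕ × ℕ) → η (proj₁ d) (proj₂ d) ≡ q)
  wonBy? q d = η (proj₁ d) (proj₂ d) ≟ᶠ q

  contains? : (u : ℕ) → Decidable (λ (d : ℕ × ℕ) → proj₁ d ≤ u × u ≤ proj₂ d)
  contains? u d = (proj₁ d ≤? u) ×-dec (u ≤? proj₂ d)

  data Tiling : ℕ → List (ℕ × ℕ) → Set where
    last : ∀ {a} → a ≤ n → Tiling a ((a , n) ∷ [])
    next : ∀ {a b cs} → a ≤ b → b < n → Tiling (suc b) cs → Tiling a ((a , b) ∷ cs)

  Covers : ℕ → List (ℕ × ℕ) → Set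
  Covers a ds = ∀ u → a ≤ u → u ≤ n → countContaining u ds ≡ 1

  StartsFrom : ℕ → ℕ × ℕ → Set
  StartsFrom a d = a ≤ proj₁ d

  tiling-valid : ∀ {a cs} → 1 ≤ a → Tiling a cs → All ValidDistrict cs
  tiling-valid 1≤a (last a≤n)           = (1≤a , a≤n , ≤-refl) ∷ []
  tiling-valid 1≤a (next a≤b b<n tiles) = (1≤a , a≤b , <⇒≤ b<n) ∷ tiling-valid (s≤s z≤n) tiles

  tiling-misses : ∀ {a cs u} → Tiling a cs → u < a → countContaining u cs ≡ 0
  tiling-misses {u = u} (last _) u<a = count-reject (contains? u) [] (<⇒≱ u<a ∘ proj₁)
  tiling-misses {u = u} (next {cs = cs} a≤b _ tiles) u<a =
    trans (count-reject (contains? u) cs (<⇒≱ u<a ∘ proj₁))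
          (tiling-misses tiles (≤-trans u<a (m≤n⇒m≤1+n a≤b)))

  tiling-covers : ∀ {a cs} → Tiling a cs → Covers a cs
  tiling-covers (last _) u a≤u u≤n = count-accept (contains? u) [] (a≤u , u≤n)
  tiling-covers (next {a} {b} {cs} a≤b _ tiles) u a≤u u≤n with u ≤? b
  ... | yes u≤b = trans (count-accept (contains? u) {x = a , b} cs (a≤u , u≤b))
                        (cong suc (tiling-misses tiles (s≤s u≤b)))
  ... | no  u≰b = trans (count-reject (contains? u) {x = a , b} cs (u≰b ∘ proj₂))
                        (tiling-covers tiles u (≰⇒> u≰b) u≤n)

  covers-↭ : ∀ {a ds es} → ds ↭ es → Covers a ds → Covers a es
  covers-↭ ds↭es covers u a≤u u≤n = trans (sym (count-↭ (contains? u) ds↭es)) (covers u a≤u u≤n)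

  -- Another district starting at some x ≤ b would be a second district containing x.
  covers-∷⇒starts-after : ∀ {a b ds} → All ValidDistrict ds → All (StartsFrom a) ds →
                          Covers a ((a , b) ∷ ds) → All (StartsFrom (suc b)) ds
  covers-∷⇒starts-after {a} {b} {ds} valid starts covers = All.tabulate startsAfter
    where
    startsAfter : ∀ {d} → d ∈ ds → suc b ≤ proj₁ d
    startsAfter {x , y} d∈ds with x ≤? b
    ... | no  x≰b = ≰⇒> x≰b
    ... | yes x≤b = ⊥-elim (1+n≰n (begin
      2                                  ≤⟨ s≤s (∈⇒1≤count (contains? x) d∈ds (≤-refl , x≤y)) ⟩
      suc (countContaining x ds)         ≡⟨ count-accept (contains? x) ds (a≤x , x≤b) ⟨
      countContaining x ((a , b) ∷ ds)   ≡⟨ covers x a≤x (≤-trans x≤y y≤n) ⟩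
      1                                  ∎))
      where
      open ≤-Reasoning
      a≤x = All.lookup starts d∈ds
      x≤y = proj₁ (proj₂ (All.lookup valid d∈ds))
      y≤n = proj₂ (proj₂ (All.lookup valid d∈ds))

  covers-∷⇒covers-after : ∀ {a b ds} → a ≤ b → Covers a ((a , b) ∷ ds) → Covers (suc b) ds
  covers-∷⇒covers-after {a} {b} {ds} a≤b covers u b<u u≤n =
    trans (sym (count-reject (contains? u) {x = a , b} ds (<⇒≱ b<u ∘ proj₂)))
          (covers u (≤-trans a≤b (<⇒≤ b<u)) u≤n)

  starts-after-n⇒[] : ∀ {ds} → All ValidDistrict ds → All (StartsFrom (suc n)) ds → ds ≡ []
  starts-after-n⇒[] []                       _            = refl
  starts-after-n⇒[] ((_ , i≤j , j≤n) ∷ _) (n<i ∷ _) = ⊥-elim (1+n≰n (≤-trans n<i (≤-trans i≤j j≤n)))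

  -- Sorting a partition by induction on N = length ds: the district containing a must start at a,
  -- and the remaining districts cover [b+1, n].
  partition⇒tiling : ∀ N {a ds} → length ds ≡ N → a ≤ n → All ValidDistrict ds →
                     All (StartsFrom a) ds → Covers a ds → ∃ λ cs → Tiling a cs × ds ↭ cs
  tiling-from-first : ∀ N {a b rest} → length rest ≡ N → a ≤ b → All ValidDistrict ((a , b) ∷ rest) →
                      All (StartsFrom a) ((a , b) ∷ rest) → Covers a ((a , b) ∷ rest) →
                      ∃ λ cs → Tiling a cs × (a , b) ∷ rest ↭ cs

  partition⇒tiling zero    {a} {[]}    _ a≤n _ _ covers with () ← covers a ≤-refl a≤n
  partition⇒tiling (suc N) {a} {ds} len a≤n valid starts covers
    with (x , b) , d∈ds , x≤a , a≤b ← 1≤count⇒∈ (contains? a) ds (≤-reflexive (sym (covers a ≤-refl a≤n)))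
    with refl ← ≤-antisym x≤a (All.lookup starts d∈ds)
    with before , after , refl ← ∈-∃++ d∈ds
    with toFront ← shift (a , b) before after
    with cs , tiles , π ← tiling-from-first N (suc-injective (trans (sym (↭-length toFront)) len)) a≤b
                            (All-resp-↭ toFront valid) (All-resp-↭ toFront starts) (covers-↭ toFront covers)
    = cs , tiles , ↭-trans toFront π

  tiling-from-first N {a} {b} {rest} len a≤b ((_ , _ , b≤n) ∷ valid) (_ ∷ starts) covers
    with b ≟ n
  ... | yes refl
    with refl ← starts-after-n⇒[] valid (covers-∷⇒starts-after valid starts covers)
    = _ , last a≤b , ↭-refl
  ... | no b≢n
    with b<n ← ≤∧≢⇒< b≤n b≢n
    with cs , tiles , π ← partition⇒tiling N len b<n valid
                            (covers-∷⇒starts-after valid starts covers) (covers-∷⇒covers-after a≤b covers)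
    = (a , b) ∷ cs , next a≤b b<n tiles , prep (a , b) π

  InRange : ℕ → Set
  InRange ℓ = 1 ≤ ℓ × ℓ ≤ kstar ∸ 1

  data LabelFor : ℕ × ℕ → Maybe (Label m) → Set where
    unlabelled : ∀ {i j} → η i j ≡ p → LabelFor (i , j) nothing
    labelled   : ∀ {i j ℓ} → η i j ≢ p → InRange ℓ → LabelFor (i , j) (just (η i j , ℓ))

  arc-label : ∀ {i j y l} → Arc (v i j) y l → LabelFor (i , j) l
  arc-label (vv-lab _ _ _ _ _ _ _ _ ≢p 1≤ℓ ℓ≤k⋆-1) = labelled ≢p (1≤ℓ , ℓ≤k⋆-1)
  arc-label (vv-unl _ _ _ _ _ _ _ ≡p)              = unlabelled ≡p
  arc-label (vt-lab _ _ _ _ ≢p 1≤ℓ ℓ≤k⋆-1)         = labelled ≢p (1≤ℓ , ℓ≤k⋆-1)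
  arc-label (vt-unl _ _ _ ≡p)                      = unlabelled ≡p

  inner-arc : ∀ {i j r l} → LabelFor (i , j) l → 1 ≤ i → i ≤ j → j < r → r ≤ n → Arc (v i j) (v (suc j) r) l
  inner-arc (unlabelled ≡p)            1≤i i≤j j<r r≤n = vv-unl _ _ _ 1≤i i≤j j<r r≤n ≡p
  inner-arc (labelled ≢p (1≤ℓ , ℓ≤)) 1≤i i≤j j<r r≤n = vv-lab _ _ _ _ 1≤i i≤j j<r r≤n ≢p 1≤ℓ ℓ≤

  final-arc : ∀ {i l} → LabelFor (i , n) l → 1 ≤ i → i ≤ n → Arc (v i n) t l
  final-arc (unlabelled ≡p)            1≤i i≤n = vt-unl _ 1≤i i≤n ≡p
  final-arc (labelled ≢p (1≤ℓ , ℓ≤)) 1≤i i≤n = vt-lab _ _ 1≤i i≤n ≢p 1≤ℓ ℓ≤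

  vertices : List (ℕ × ℕ) → List HV
  vertices []             = t ∷ []
  vertices ((i , j) ∷ cs) = v i j ∷ vertices cs

  length-vertices : ∀ cs → length (vertices cs) ≡ suc (length cs)
  length-vertices []       = refl
  length-vertices (_ ∷ cs) = cong suc (length-vertices cs)

  walk⇒tiling : ∀ {a b vs ls} → Walk (v a b) t vs ls →
                ∃ λ cs → Tiling a cs × vs ≡ vertices cs × Pointwise LabelFor cs ls
  walk⇒tiling (step arc@(vv-lab _ _ _ _ _ a≤b b<r r≤n _ _ _) w)
    with cs , tiles , refl , labs ← walk⇒tiling w
    = _ , next a≤b (≤-trans b<r r≤n) tiles , refl , arc-label arc ∷ labs
  walk⇒tiling (step arc@(vv-unl _ _ _ _ a≤b b<r r≤n _) w)
    with cs , tiles , refl , labs ← walk⇒tiling w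
    = _ , next a≤b (≤-trans b<r r≤n) tiles , refl , arc-label arc ∷ labs
  walk⇒tiling (step arc@(vt-lab _ _ _ a≤n _ _ _) here) = _ , last a≤n , refl , arc-label arc ∷ []
  walk⇒tiling (step arc@(vt-unl _ _ a≤n _) here)       = _ , last a≤n , refl , arc-label arc ∷ []
  walk⇒tiling (step (vt-lab _ _ _ _ _ _ _) (step () _))
  walk⇒tiling (step (vt-unl _ _ _ _) (step () _))

  tiling⇒walk : ∀ {a b cs ls} → 1 ≤ a → Tiling a ((a , b) ∷ cs) → Pointwise LabelFor ((a , b) ∷ cs) ls →
                Walk (v a b) t (vertices ((a , b) ∷ cs)) ls
  tiling⇒walk 1≤a (last a≤n) (lab ∷ []) = step (final-arc lab 1≤a a≤n) here
  tiling⇒walk 1≤a (next a≤b b<n tiles@(last _)) (lab ∷ labs) =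
    step (inner-arc lab 1≤a a≤b b<n ≤-refl) (tiling⇒walk (s≤s z≤n) tiles labs)
  tiling⇒walk 1≤a (next a≤b _ tiles@(next b<r r<n _)) (lab ∷ labs) =
    step (inner-arc lab 1≤a a≤b b<r (<⇒≤ r<n)) (tiling⇒walk (s≤s z≤n) tiles labs)

  walk-from-s : ∀ {cs ls} → Tiling 1 cs → Pointwise LabelFor cs ls → Walk s t (s ∷ vertices cs) (nothing ∷ ls)
  walk-from-s tiles@(last 1≤n)               labs = step (sv n 1≤n ≤-refl) (tiling⇒walk ≤-refl tiles labs)
  walk-from-s tiles@(next {b = b} 1≤b b<n _) labs = step (sv b 1≤b (<⇒≤ b<n)) (tiling⇒walk ≤-refl tiles labs)

  RightOf : ℕ → HV → Set
  RightOf a (v x _) = a ≤ x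
  RightOf a t       = ⊤
  RightOf a s       = ⊥

  rightOf-≤ : ∀ {a b} → a ≤ b → ∀ {w} → RightOf b w → RightOf a w
  rightOf-≤ a≤b {v _ _} b≤x = ≤-trans a≤b b≤x
  rightOf-≤ a≤b {t}     _   = _

  vertices-rightOf : ∀ {a cs} → Tiling a cs → All (RightOf a) (vertices cs)
  vertices-rightOf (last _)                   = ≤-refl ∷ _ ∷ []
  vertices-rightOf (next {b = b} a≤b _ tiles) = ≤-refl ∷ All.map (rightOf-≤ (m≤n⇒m≤1+n a≤b)) (vertices-rightOf tiles)

  rightOf-≢ : ∀ {a b} → a ≤ b → ∀ w → RightOf (suc b) w → v a b ≢ w
  rightOf-≢ a≤b (v _ _) b<a refl = 1+n≰n (≤-trans b<a a≤b)

  vertices-unique : ∀ {a cs} → Tiling a cs → Unique (vertices cs)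
  vertices-unique (last _)            = ((λ ()) ∷ []) ∷ [] ∷ []
  vertices-unique (next a≤b _ tiles) = All.map (rightOf-≢ a≤b _) (vertices-rightOf tiles) ∷ vertices-unique tiles

  s∉vertices : ∀ cs → All (s ≢_) (vertices cs)
  s∉vertices []       = (λ ()) ∷ []
  s∉vertices (_ ∷ cs) = (λ ()) ∷ s∉vertices cs

  labels : List (Maybe (Label m)) → List (Label m)
  labels = mapMaybe id

  unlabelledCount : List (Maybe (Label m)) → ℕ
  unlabelledCount ls = length (filter (λ l → T? (isNothing l)) ls)

  hasCandidate? : (q : Fin m) → Decidable (λ (l : Label m) → proj₁ l ≡ q)
  hasCandidate? q l = proj₁ l ≟ᶠ q

  labels+unlabelled≡length : ∀ ls → length (labels ls) + unlabelledCount ls ≡ length ls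
  labels+unlabelled≡length []             = refl
  labels+unlabelled≡length (just _ ∷ ls)  = cong suc (labels+unlabelled≡length ls)
  labels+unlabelled≡length (nothing ∷ ls) = trans (+-suc _ _) (cong suc (labels+unlabelled≡length ls))

  unlabelledCount≡wins : ∀ {cs ls} → Pointwise LabelFor cs ls → unlabelledCount ls ≡ wins p cs
  unlabelledCount≡wins []                               = refl
  unlabelledCount≡wins {_ ∷ cs} (unlabelled ≡p ∷ labs) =
    trans (cong suc (unlabelledCount≡wins labs)) (sym (count-accept (wonBy? p) cs ≡p))
  unlabelledCount≡wins {_ ∷ cs} (labelled ≢p _ ∷ labs) =
    trans (unlabelledCount≡wins labs) (sym (count-reject (wonBy? p) cs ≢p))

  labelCount≡wins : ∀ {q cs ls} → q ≢ p → Pointwise LabelFor cs ls →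
                    count (hasCandidate? q) (labels ls) ≡ wins q cs
  labelCount≡wins q≢p [] = refl
  labelCount≡wins {q} {_ ∷ cs} q≢p (unlabelled ≡p ∷ labs) =
    trans (labelCount≡wins q≢p labs) (sym (count-reject (wonBy? q) cs (λ ≡q → q≢p (trans (sym ≡q) ≡p))))
  labelCount≡wins {q} q≢p (labelled _ _ ∷ labs) =
    count-∷-cong (hasCandidate? q) (wonBy? q) id id (labelCount≡wins q≢p labs)

  labels-inRange : ∀ {cs ls} → Pointwise LabelFor cs ls → All (InRange ∘ proj₂) (labels ls)
  labels-inRange []                          = []
  labels-inRange (unlabelled _ ∷ labs)       = labels-inRange labs
  labels-inRange (labelled _ inRange ∷ labs) = inRange ∷ labels-inRange labs

  labelCount≤ : ∀ q ls → Unique (labels ls) → All (InRange ∘ proj₂) (labels ls) →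
                count (hasCandidate? q) (labels ls) ≤ kstar ∸ 1
  labelCount≤ q ls unique inRange =
    unique-fibre⇒length≤ (kstar ∸ 1) (Unique.filter⁺ (hasCandidate? q) unique)
      (All.zip (All.all-filter (hasCandidate? q) (labels ls) , All.filter⁺ (hasCandidate? q) inRange))

  -- A district won by c ≠ p is labelled ⟨c,ℓ⟩ where ℓ is its rank among the districts won by c,
  -- counted from the right end of the path.
  rankLabel : ℕ × ℕ → List (ℕ × ℕ) → Maybe (Label m)
  rankLabel (i , j) later with η i j ≟ᶠ p
  ... | yes _ = nothing
  ... | no  _ = just (η i j , suc (wins (η i j) later))

  rankLabels : List (ℕ × ℕ) → List (Maybe (Label m))
  rankLabels []       = []
  rankLabels (d ∷ cs) = rankLabel d cs ∷ rankLabels cs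

  OthersWinAtMost : ℕ → List (ℕ × ℕ) → Set
  OthersWinAtMost K cs = ∀ q → q ≢ p → wins q cs ≤ K

  othersWinAtMost-∷ : ∀ {K d cs} → OthersWinAtMost K (d ∷ cs) → OthersWinAtMost K cs
  othersWinAtMost-∷ {d = d} {cs} bounded q q≢p = ≤-trans (count-≤-∷ (wonBy? q) d cs) (bounded q q≢p)

  rankLabels-labelFor : ∀ cs → OthersWinAtMost (kstar ∸ 1) cs → Pointwise LabelFor cs (rankLabels cs)
  rankLabels-labelFor []             _       = []
  rankLabels-labelFor ((i , j) ∷ cs) bounded with η i j ≟ᶠ p
  ... | yes ≡p = unlabelled ≡p ∷ rankLabels-labelFor cs (othersWinAtMost-∷ bounded)
  ... | no  ≢p = labelled ≢p (s≤s z≤n , rank≤) ∷ rankLabels-labelFor cs (othersWinAtMost-∷ bounded)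
    where
    rank≤ : suc (wins (η i j) cs) ≤ kstar ∸ 1
    rank≤ = ≤-trans (≤-reflexive (sym (count-accept (wonBy? (η i j)) cs refl))) (bounded (η i j) ≢p)

  ≤wins-∷ : ∀ d cs {ls : List (Label m)} → All (λ l → proj₂ l ≤ wins (proj₁ l) cs) ls →
            All (λ l → proj₂ l ≤ wins (proj₁ l) (d ∷ cs)) ls
  ≤wins-∷ d cs = All.map (λ {l} ℓ≤ → ≤-trans ℓ≤ (count-≤-∷ (wonBy? (proj₁ l)) d cs))

  rank≤wins : ∀ cs → All (λ l → proj₂ l ≤ wins (proj₁ l) cs) (labels (rankLabels cs))
  rank≤wins []             = []
  rank≤wins ((i , j) ∷ cs) with η i j ≟ᶠ p
  ... | yes _ = ≤wins-∷ (i , j) cs (rank≤wins cs)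
  ... | no  _ = ≤-reflexive (sym (count-accept (wonBy? (η i j)) cs refl))
              ∷ ≤wins-∷ (i , j) cs (rank≤wins cs)

  rankLabels-unique : ∀ cs → Unique (labels (rankLabels cs))
  rankLabels-unique []             = []
  rankLabels-unique ((i , j) ∷ cs) with η i j ≟ᶠ p
  ... | yes _ = rankLabels-unique cs
  ... | no  _ = All.map (λ { ℓ≤ refl → 1+n≰n ℓ≤ }) (rank≤wins cs) ∷ rankLabels-unique cs

  labelledTiling⇒partition : ∀ {k cs ls} → Tiling 1 cs → Pointwise LabelFor cs ls → length cs ≡ k →
                             unlabelledCount ls ≡ kstar → Unique (labels ls) → GoodPartition k
  labelledTiling⇒partition {cs = cs} {ls} tiles labs len unlabelled≡k⋆ unique =
    mk cs (tiling-valid ≤-refl tiles) (tiling-covers tiles) len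
       (trans (sym (unlabelledCount≡wins labs)) unlabelled≡k⋆) othersWin
    where
    othersWin : OthersWinAtMost (kstar ∸ 1) cs
    othersWin q q≢p = ≤-trans (≤-reflexive (sym (labelCount≡wins q≢p labs)))
                              (labelCount≤ q ls unique (labels-inRange labs))

  path⇒partition : ∀ {k} → GoodPath k → GoodPartition k
  path⇒partition (mk _ (_ ∷ _) (step (sv _ _ _) walk) _ nVerts _ uniqueLabels nUnlabelled)
    with cs , tiles , refl , labs ← walk⇒tiling walk
    = labelledTiling⇒partition tiles labs
        (+-cancelʳ-≡ 2 _ _ (trans (+-comm (length cs) 2) (trans (sym (cong suc (length-vertices cs))) nVerts)))
        (suc-injective (trans nUnlabelled (+-comm kstar 1)))
        uniqueLabels

  tiling⇒path : ∀ {k cs} → Tiling 1 cs → length cs ≡ k → wins p cs ≡ kstar →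
                OthersWinAtMost (kstar ∸ 1) cs → GoodPath k
  tiling⇒path {k} {cs} tiles len pWins othersWin =
    mk (s ∷ vertices cs) (nothing ∷ ls) (walk-from-s tiles labs) (s∉vertices cs ∷ vertices-unique tiles)
       nVerts nLabelled (rankLabels-unique cs) nUnlabelled
    where
    ls = rankLabels cs
    labs = rankLabels-labelFor cs othersWin
    unlabelled≡k⋆ : unlabelledCount ls ≡ kstar
    unlabelled≡k⋆ = trans (unlabelledCount≡wins labs) pWins
    nVerts : suc (length (vertices cs)) ≡ k + 2
    nVerts = trans (cong suc (length-vertices cs)) (trans (cong (2 +_) len) (+-comm 2 k))
    nUnlabelled : suc (unlabelledCount ls) ≡ kstar + 1
    nUnlabelled = trans (cong suc unlabelled≡k⋆) (+-comm 1 kstar)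
    nLabelled : length (labels ls) ≡ k ∸ kstar
    nLabelled = begin
      length (labels ls)                                ≡⟨ m+n∸n≡m _ kstar ⟨
      length (labels ls) + kstar ∸ kstar                ≡⟨ cong (λ u → length (labels ls) + u ∸ kstar) unlabelled≡k⋆ ⟨
      length (labels ls) + unlabelledCount ls ∸ kstar   ≡⟨ cong (_∸ kstar) (labels+unlabelled≡length ls) ⟩
      length ls ∸ kstar                                 ≡⟨ cong (_∸ kstar) (trans (sym (Pointwise-length labs)) len) ⟩
      k ∸ kstar                                         ∎
      where open ≡-Reasoning

  valid-nonempty⇒1≤n : ∀ {ds} → All ValidDistrict ds → 1 ≤ length ds → 1 ≤ n
  valid-nonempty⇒1≤n ((1≤i , i≤j , j≤n) ∷ _) _ = ≤-trans 1≤i (≤-trans i≤j j≤n)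

  partition⇒path : ∀ {k} → 1 ≤ k → GoodPartition k → GoodPath k
  partition⇒path 1≤k (mk ds valid covers nDistricts pWins othersWin)
    with cs , tiles , ds↭cs ← partition⇒tiling _ refl (valid-nonempty⇒1≤n valid (≤-trans 1≤k (≤-reflexive (sym nDistricts))))
                                valid (All.map proj₁ valid) covers
    = tiling⇒path tiles (trans (sym (↭-length ds↭cs)) nDistricts) (trans (sym (winsOf p)) pWins)
        (λ q q≢p → ≤-trans (≤-reflexive (sym (winsOf q))) (othersWin q q≢p))
    where
    winsOf : ∀ q → wins q ds ≡ wins q cs
    winsOf q = count-↭ (wonBy? q) ds↭cs

lemma3 : (n m : ℕ) (w : ℕ → Fin m → ℕ) (p : Fin m) (k kstar : ℕ) →
         PositiveWeights n m w → 1 ≤ k → 1 ≤ kstar →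
         (η : ℕ → ℕ → Fin m) → IsTieBreaking n m w η →
         AuxGraph.GoodPath n m η p kstar k ⇔ AuxGraph.GoodPartition n m η p kstar k
lemma3 n m w p k kstar _ 1≤k _ η _ = mk⇔ (path⇒partition n m η p kstar) (partition⇒path n m η p kstar 1≤k)
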